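{- Let $\mathbf s\in{\rm Score}(C_n)$ and let $d$ be the degree of ${\rm IntGr}(C_n,\mathbf s)$. Any given double edge in ${\rm IntGr}(C_n,\mathbf s)$ is contained in at most $\min\{d,2n\}$ crystals.
   Context: Vectors: $\mathbf e^{\pm}_{ij}=\mathbf e_i\pm\mathbf e_j$ ($i>j$), $\mathbf e^\ell_i=2\mathbf e_i$ for negative edges $e^-_{ij}$, positive edges $e^+_{ij}$, loops $e^\ell_i$. $\mathcal K_{C_n}$ is the signed graph on $[n]$ with all negative and positive edges (one of each per pair) and all loops. A Coxeter tournament on $\mathcal K_{C_n}$ is $(w_e)$, $w_e\in\{0,1\}$, over its edges (games); score $\sum_e(w_e-\frac12)\mathbf e$; a sub-tournament is neutral if this sum over its games is $\mathbf 0$; $\mathcal T*\mathcal X$ flips outcomes of the games of $\mathcal X$. ${\rm Score}(C_n)$ = set of score sequences of tournaments on $\mathcal K_{C_n}$. A copy of a type-$C_n$ generator is a neutral sub-tournament whose games are either (neutral triangle) three negative edges pairwise joining three distinct vertices, or one negative and two positive edges pairwise joining three distinct vertices, or (neutral clover) $e^-_{ij},e^+_{ij},e^\ell_i$. ${\rm IntGr}(C_n,\mathbf s)$: multigraph on tournaments on $\mathcal K_{C_n}$ with score $\mathbf s$, $\mathcal T_1,\mathcal T_2$ joined iff $\mathcal T_2=\mathcal T_1*\mathcal G$ for a generator copy $\mathcal G\subseteq\mathcal T_1$ (double edge if clover, single otherwise). It is known that this multigraph is regular; $d$ denotes its common degree (double edges counted twice). For $\mathcal T_1,\mathcal T_2$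 at distance two, $N(\mathcal T_1,\mathcal T_2)$ is the union of all paths of length two between them, and the extended interchange network $\hat N(\mathcal T_1,\mathcal T_2)$ is the union of $N(\mathcal T_1',\mathcal T_2')$ over all pairs of vertices of $N(\mathcal T_1,\mathcal T_2)$ at distance two. A crystal is an extended interchange network isomorphic to the multigraph on six distinct vertices $a,b,c,d,y,z$ with single edges $ab,bc,cd,da$ and double edges $ay,cy,bz,dz$ (and no other edges). -}

module Defs where

open import Data.Nat using (ℕ; zero; suc)
open import Data.Bool using (Bool; true; false; not; if_then_else_; _∨_; _∧_; _xor_)
open import Data.Fin using (Fin; _<_; toℕ)
open import Data.Fin.Properties using (_≟_; _<?_)
open import Data.Integer using (ℤ; +_; -[1+_]; 0ℤ; 1ℤ) renaming (_+_ to _+ℤ_; _*_ to _*ℤ_; _-_ to _-ℤ_)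
open import Data.List using (List; []; _∷_; _++_; map; concatMap; foldr; allFin)
open import Data.Nat.ListAction using (sum)
open import Data.List.Relation.Unary.All using (All)
open import Data.List.Relation.Unary.Any using (Any)
open import Data.List.Relation.Unary.AllPairs using (AllPairs)
open import Data.Product using (Σ; _×_; _,_; proj₁; proj₂)
open import Data.Sum using (_⊎_)
open import Data.Empty using (⊥)
open import Relation.Nullary using (¬_; yes; no)
open import Relation.Nullary.Decidable using (⌊_⌋)
open import Relation.Binary.PropositionalEquality using (_≡_; _≢_)

-- The signed graph K_{C_n}: games (edges) on the vertex set [n] = Fin n
--   neg i j  = e^-_{ij}  (i > j),   vector e_i - e_j
--   pos i j  = e^+_{ij}  (i > j),   vector e_i + e_j
--   loop i   = e^l_i,                vector 2 e_i

data Game (n : ℕ) : Set where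
  neg  : (i j : Fin n) → .(j < i) → Game n
  pos  : (i j : Fin n) → .(j < i) → Game n
  loop : Fin n → Game n

pairGames : {n : ℕ} → Fin n → Fin n → List (Game n)
pairGames i j with j <? i
... | yes p = neg i j p ∷ pos i j p ∷ []
... | no _  = []

allGames : (n : ℕ) → List (Game n)
allGames n =
  concatMap (λ i → concatMap (λ j → pairGames i j) (allFin n)) (allFin n)
  ++ map loop (allFin n)

δ : {n : ℕ} → Fin n → Fin n → ℤ
δ k i = if ⌊ k ≟ i ⌋ then 1ℤ else 0ℤ

coord : {n : ℕ} → Game n → Fin n → ℤ
coord (neg i j _) k = δ k i -ℤ δ k j
coord (pos i j _) k = δ k i +ℤ δ k j
coord (loop i)    k = δ k i +ℤ δ k i

sumℤ : List ℤ → ℤ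
sumℤ = foldr _+ℤ_ 0ℤ

-- Tournaments: an outcome w_e ∈ {0,1} (false/true) for every game.

Tournament : ℕ → Set
Tournament n = Game n → Bool

_≈T_ : {n : ℕ} → Tournament n → Tournament n → Set
T ≈T T' = ∀ g → T g ≡ T' g

-- 2 (w - 1/2) ∈ {+1, -1}
sgn : Bool → ℤ
sgn true  = 1ℤ
sgn false = -[1+ 0 ]

-- DOUBLED score: score2 T = 2 * Σ_e (w_e - 1/2) e   (an integer vector)
score2 : {n : ℕ} → Tournament n → Fin n → ℤ
score2 {n} T k = sumℤ (map (λ g → sgn (T g) *ℤ coord g k) (allGames n))

HasScore : {n : ℕ} → Tournament n → (Fin n → ℤ) → Set
HasScore T s = ∀ k → score2 T k ≡ s k

-- s ∈ Score(C_n)   (s is the doubled score vector)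
InScore : {n : ℕ} → (Fin n → ℤ) → Set
InScore {n} s = Σ (Tournament n) λ T → HasScore T s

-- Sub-tournaments of T are given by a set of games G (indicator), with the
-- outcomes of T.  Neutral: Σ_{e ∈ G} (w_e - 1/2) e = 0 (doubled).

Neutral : {n : ℕ} → Tournament n → (Game n → Bool) → Set
Neutral {n} T G = ∀ k →
  sumℤ (map (λ g → if G g then sgn (T g) *ℤ coord g k else 0ℤ) (allGames n)) ≡ 0ℤ

flipT : {n : ℕ} → Tournament n → (Game n → Bool) → Tournament n
flipT T G g = T g xor G g

negE : {n : ℕ} → Fin n → Fin n → Game n → Bool
negE x y (neg i j _) = (⌊ i ≟ x ⌋ ∧ ⌊ j ≟ y ⌋) ∨ (⌊ i ≟ y ⌋ ∧ ⌊ j ≟ x ⌋)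
negE x y (pos _ _ _) = false
negE x y (loop _)    = false

posE : {n : ℕ} → Fin n → Fin n → Game n → Bool
posE x y (neg _ _ _) = false
posE x y (pos i j _) = (⌊ i ≟ x ⌋ ∧ ⌊ j ≟ y ⌋) ∨ (⌊ i ≟ y ⌋ ∧ ⌊ j ≟ x ⌋)
posE x y (loop _)    = false

loopE : {n : ℕ} → Fin n → Game n → Bool
loopE x (loop i) = ⌊ i ≟ x ⌋
loopE x _        = false

Distinct3 : {n : ℕ} → Fin n → Fin n → Fin n → Set
Distinct3 a b c = (a ≢ b) × (b ≢ c) × (a ≢ c)

IsTriangleShape : {n : ℕ} → (Game n → Bool) → Set
IsTriangleShape {n} G = Σ (Fin n) λ a → Σ (Fin n) λ b → Σ (Fin n) λ c → Distinct3 a b c ×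
  ((∀ g → G g ≡ (negE a b g ∨ negE b c g ∨ negE a c g))
   ⊎ (∀ g → G g ≡ (negE a b g ∨ posE b c g ∨ posE a c g)))

IsCloverShape : {n : ℕ} → (Game n → Bool) → Set
IsCloverShape {n} G = Σ (Fin n) λ i → Σ (Fin n) λ j → (i ≢ j) ×
  (∀ g → G g ≡ (negE i j g ∨ posE i j g ∨ loopE i g))

-- The model crystal on vertices a=0, b=1, c=2, d=3, y=4, z=5:
-- single edges ab, bc, cd, da; double edges ay, cy, bz, dz.

cm : ℕ → ℕ → ℕ
cm 0 1 = 1
cm 1 0 = 1
cm 1 2 = 1
cm 2 1 = 1
cm 2 3 = 1
cm 3 2 = 1
cm 3 0 = 1
cm 0 3 = 1
cm 0 4 = 2
cm 4 0 = 2
cm 2 4 = 2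
cm 4 2 = 2
cm 1 5 = 2
cm 5 1 = 2
cm 3 5 = 2
cm 5 3 = 2
cm _ _ = 0

crystalMult : Fin 6 → Fin 6 → ℕ
crystalMult u v = cm (toℕ u) (toℕ v)

module IntGr {n : ℕ} (s : Fin n → ℤ) where

  record Vertex : Set where
    constructor vtx
    field
      tour  : Tournament n
      score : HasScore tour s
  open Vertex public

  _≈_ : Vertex → Vertex → Set
  u ≈ v = tour u ≈T tour v

  Single : Vertex → Vertex → Set
  Single u v = Σ (Game n → Bool) λ G →
    IsTriangleShape G × Neutral (tour u) G × (tour v ≈T flipT (tour u) G)

  Double : Vertex → Vertex → Set
  Double u v = Σ (Game n → Bool) λ G →
    IsCloverShape G × Neutral (tour u) G × (tour v ≈T flipT (tour u) G)

  Adj : Vertex → Vertex → Set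
  Adj u v = Single u v ⊎ Double u v

  Mult : Vertex → Vertex → ℕ → Set
  Mult u v zero             = ¬ Adj u v
  Mult u v (suc zero)       = Single u v
  Mult u v (suc (suc zero)) = Double u v
  Mult u v (suc (suc (suc _))) = ⊥

  HasDegree : Vertex → ℕ → Set
  HasDegree u d = Σ (List (Vertex × ℕ)) λ L →
    All (λ p → Adj u (proj₁ p) × Mult u (proj₁ p) (proj₂ p)) L ×
    AllPairs (λ p q → ¬ (proj₁ p ≈ proj₁ q)) L ×
    (∀ x → Adj u x → Any (λ p → x ≈ proj₁ p) L) ×
    sum (map proj₂ L) ≡ d

  IsDegree : ℕ → Set
  IsDegree d = ∀ u → HasDegree u d

  Dist2 : Vertex → Vertex → Set
  Dist2 u v = ¬ (u ≈ v) × ¬ Adj u v × Σ Vertex (λ x → Adj u x × Adj x v)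

  CommonNb : Vertex → Vertex → Vertex → Set
  CommonNb u v x = Adj u x × Adj x v

  VertN : Vertex → Vertex → Vertex → Set
  VertN u v w = w ≈ u ⊎ w ≈ v ⊎ Σ Vertex (λ x → CommonNb u v x × w ≈ x)

  EdgeN : Vertex → Vertex → Vertex → Vertex → Set
  EdgeN u v a b = Σ Vertex λ x → CommonNb u v x ×
    ((a ≈ u × b ≈ x) ⊎ (a ≈ x × b ≈ u) ⊎ (a ≈ x × b ≈ v) ⊎ (a ≈ v × b ≈ x))

  VertÑ : Vertex → Vertex → Vertex → Set
  VertÑ u v w = Σ Vertex λ u' → Σ Vertex λ v' →
    VertN u v u' × VertN u v v' × Dist2 u' v' × VertN u' v' w

  EdgeÑ : Vertex → Vertex → Vertex → Vertex → Set
  EdgeÑ u v a b = Σ Vertex λ u' → Σ Vertex λ v' →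
    VertN u v u' × VertN u v v' × Dist2 u' v' × EdgeN u' v' a b

  MultÑ : Vertex → Vertex → Vertex → Vertex → ℕ → Set
  MultÑ u v a b zero             = ¬ EdgeÑ u v a b
  MultÑ u v a b (suc zero)       = EdgeÑ u v a b × Single a b
  MultÑ u v a b (suc (suc zero)) = EdgeÑ u v a b × Double a b
  MultÑ u v a b (suc (suc (suc _))) = ⊥

  IsoCrystal : Vertex → Vertex → Set
  IsoCrystal u v = Σ (Fin 6 → Vertex) λ f →
    (∀ i j → f i ≈ f j → i ≡ j) ×
    (∀ i → VertÑ u v (f i)) ×
    (∀ w → VertÑ u v w → Σ (Fin 6) λ i → w ≈ f i) ×
    (∀ i j → MultÑ u v (f i) (f j) (crystalMult i j))

  IsCrystal : Vertex → Vertex → Set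
  IsCrystal u v = Dist2 u v × IsoCrystal u v

  SameNet : Vertex × Vertex → Vertex × Vertex → Set
  SameNet (u , v) (u' , v') = ∀ a b →
    (EdgeÑ u v a b → EdgeÑ u' v' a b) × (EdgeÑ u' v' a b → EdgeÑ u v a b)

{-# OPTIONS --safe #-}
module Submission where

-- The model crystal lives on Fin 6: the square 0–1–2–3 of single edges, and the hubs 4 and 5,
-- joined by double edges to 0, 2 and to 1, 3 respectively.
--
-- Triangle moves fix the outcome of every loop game, whereas a clover move with centre i flips the
-- loop at i only. Up to a rotation of the model, a double edge ab of a crystal is the edge 4–0, with
-- the hub 4 at a, say. The double edge 4–2 is then a clover move from a, and since 2 is also reached
-- from b = 0 along the single edges 0–1–2, both clover moves flip the same loop: vertex 2 is
-- a * clover(i, k), where i is the centre of ab. Moreover a crystal is determined by its vertices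
-- 0, 2 and 4: vertices 1 and 3 are the common neighbours of the diagonal 0, 2 other than 4, and 5 is
-- the common neighbour of the diagonal 1, 3 other than 0 and 2. So a crystal through ab is
-- determined by the side of its hub together with k ∈ [n], which leaves at most 2n of them, and also
-- by the side of its hub together with vertex 2 among the double neighbours of the hub, which
-- leaves at most d/2 + d/2.

open import Defs
open import Data.Nat using (ℕ; _≤_; _*_; _⊓_)
open import Data.Fin using (Fin)
open import Data.Integer using (ℤ)
open import Data.List using (List; length)
open import Data.List.Relation.Unary.All using (All)
open import Data.List.Relation.Unary.AllPairs using (AllPairs)
open import Data.Product using (_×_; proj₁; proj₂)
open import Relation.Nullary using (¬_)

open import Data.Bool using (Bool; true; false; not; _∨_; _xor_; if_then_else_)
open import Data.Bool.Properties using (xor-identityʳ; xor-comm; not-injective; not-¬; T-≡)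
open import Data.Fin using (zero; suc; toℕ; join; splitAt) renaming (_<_ to _<ᶠ_)
open import Data.Fin.Patterns using (0F; 1F; 2F; 3F; 4F; 5F)
open import Data.Fin.Permutation
  using (Permutation′; permutation; _⟨$⟩ʳ_; _⟨$⟩ˡ_; inverseˡ; inverseʳ; flip; transpose; _∘ₚ_) renaming (id to idₚ)
open import Data.Fin.Properties
  using (all?; any?; injective⇒≤; <-cmp; splitAt-join) renaming (_≟_ to _≟ᶠ_)
open import Data.Integer using (0ℤ; -_) renaming (_+_ to _+ℤ_; _*_ to _*ℤ_)
open import Data.Integer.Properties using (neg-distrib-+; neg-distribˡ-*)
open import Data.List using ([]; _∷_; map; lookup)
open import Data.List.Membership.Propositional.Properties using (∈-lookup)
open import Data.List.Properties using (map-cong)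
import Data.List.Relation.Unary.All as All
open import Data.List.Relation.Unary.All using (_∷_)
open import Data.List.Relation.Unary.AllPairs using (_∷_)
open import Data.List.Relation.Unary.Any using (Any; here; there; index)
open import Data.List.Relation.Unary.Any.Properties using (lookup-index)
open import Data.Nat using (zero; suc; _+_; _≟_; z≤n; s≤s; s<s)
open import Data.Nat.ListAction using (sum)
open import Data.Nat.Properties
  using (≤-trans; ≤-reflexive; ≤-refl; ≤-total; +-mono-≤; +-suc; +-identityʳ; m≤n⇒m≤1+n; m≤n+m; ⊓-glb)
open import Data.Product using (Σ; ∃; ∃₂; _,_)
import Data.Product as Product
open import Data.Sum using (_⊎_; inj₁; inj₂)
import Data.Sum as Sum
open import Data.Sum.Properties using (inj₁-injective; inj₂-injective)
open import Function using (_∘_; id; Injective; Equivalence)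
open import Level using (Level)
open import Relation.Binary using (Rel; Setoid; tri<; tri≈; tri>)
open import Relation.Binary.PropositionalEquality
  using (_≡_; _≢_; refl; sym; trans; cong; cong₂; subst; _→-setoid_; module ≡-Reasoning)
open import Relation.Nullary using (Dec; contradiction)
open import Relation.Nullary.Decidable
  using (⌊_⌋; ¬?; _×-dec_; _⊎-dec_; _→-dec_; from-yes; toWitness; isYes≗does; dec-true)
open import Relation.Unary using (Pred)

module _ {a p r : Level} {A : Set a} {P : Pred A p} {R : Rel A r} where

  AllPairs-lookup : ∀ {xs} → AllPairs R xs → ∀ {i j} → i <ᶠ j → R (lookup xs i) (lookup xs j)
  AllPairs-lookup (Rx ∷ _)   {zero}  {suc j} _         = All.lookup Rx (∈-lookup j)
  AllPairs-lookup (_  ∷ Rxs) {suc i} {suc j} (s<s i<j) = AllPairs-lookup Rxs i<j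

  separating-key⇒length≤ : ∀ {m xs} (key : ∀ {x} → P x → Fin m) →
    (∀ {x y} (px : P x) (py : P y) → R x y → key px ≢ key py) →
    All P xs → AllPairs R xs → length xs ≤ m
  separating-key⇒length≤ {xs = xs} key separated Pxs Rxs = injective⇒≤ keyAt-injective
    where
    keyAt : Fin (length xs) → Fin _
    keyAt i = key (All.lookup Pxs (∈-lookup i))

    keyAt-injective : Injective _≡_ _≡_ keyAt
    keyAt-injective {i} {j} eq with <-cmp i j
    ... | tri< i<j _ _ = contradiction eq (separated _ _ (AllPairs-lookup Rxs i<j))
    ... | tri≈ _ i≡j _ = i≡j
    ... | tri> _ _ j<i = contradiction (sym eq) (separated _ _ (AllPairs-lookup Rxs j<i))

join-injective : ∀ m n {i j : Fin m ⊎ Fin n} → join m n i ≡ join m n j → i ≡ j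
join-injective m n {i} {j} eq =
  trans (sym (splitAt-join m n i)) (trans (cong (splitAt m) eq) (splitAt-join m n j))

module _ {a : Level} {A : Set a} where

  doubles : List (A × ℕ) → List A
  doubles []             = []
  doubles ((x , 2) ∷ xs) = x ∷ doubles xs
  doubles (_       ∷ xs) = doubles xs

  length-doubles : ∀ xs → length (doubles xs) + length (doubles xs) ≤ sum (map proj₂ xs)
  length-doubles []                             = z≤n
  length-doubles ((_ , 0) ∷ xs)                 = length-doubles xs
  length-doubles ((_ , 1) ∷ xs)                 = m≤n⇒m≤1+n (length-doubles xs)
  length-doubles ((_ , 2) ∷ xs)                 =
    s≤s (≤-trans (≤-reflexive (+-suc (length (doubles xs)) _)) (s≤s (length-doubles xs)))
  length-doubles ((_ , suc (suc (suc m))) ∷ xs) = ≤-trans (length-doubles xs) (m≤n+m _ (3 + m))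

m+m≤o⇒n+n≤o⇒m+n≤o : ∀ {m n o} → m + m ≤ o → n + n ≤ o → m + n ≤ o
m+m≤o⇒n+n≤o⇒m+n≤o {m} {n} m+m≤o n+n≤o with ≤-total m n
... | inj₁ m≤n = ≤-trans (+-mono-≤ m≤n ≤-refl) n+n≤o
... | inj₂ n≤m = ≤-trans (+-mono-≤ ≤-refl n≤m) m+m≤o

xor-cancelˡ : ∀ x {y z} → x xor y ≡ x xor z → y ≡ z
xor-cancelˡ false eq = eq
xor-cancelˡ true  eq = not-injective eq

xor-involutive : ∀ y x → (x xor y) xor y ≡ x
xor-involutive false x     = trans (xor-identityʳ _) (xor-identityʳ x)
xor-involutive true  false = refl
xor-involutive true  true  = refl

sgn-xor-true : ∀ b → sgn (b xor true) ≡ - sgn b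
sgn-xor-true false = refl
sgn-xor-true true  = refl

sumℤ-map-neg : ∀ {a} {A : Set a} (h : A → ℤ) xs → sumℤ (map (λ x → - h x) xs) ≡ - sumℤ (map h xs)
sumℤ-map-neg h []       = refl
sumℤ-map-neg h (x ∷ xs) = trans (cong (- h x +ℤ_) (sumℤ-map-neg h xs)) (sym (neg-distrib-+ (h x) _))

ModelEdge : Fin 6 → Fin 6 → Set
ModelEdge i j = crystalMult i j ≢ 0

modelEdge? : ∀ i j → Dec (ModelEdge i j)
modelEdge? i j = ¬? (crystalMult i j ≟ 0)

ModelFar : Fin 6 → Fin 6 → Set
ModelFar i j = i ≢ j × ¬ ModelEdge i j

modelFar? : ∀ i j → Dec (ModelFar i j)
modelFar? i j = ¬? (i ≟ᶠ j) ×-dec ¬? (modelEdge? i j)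

ModelN : Fin 6 → Fin 6 → Fin 6 → Set
ModelN p q r = r ≡ p ⊎ r ≡ q ⊎ (ModelEdge p r × ModelEdge r q)

modelN? : ∀ p q r → Dec (ModelN p q r)
modelN? p q r = (r ≟ᶠ p) ⊎-dec (r ≟ᶠ q) ⊎-dec (modelEdge? p r ×-dec modelEdge? r q)

ModelGenerating : Fin 6 → Fin 6 → Fin 6 → Fin 6 → Set
ModelGenerating p q a b = ModelN p q a × ModelN p q b × ModelFar a b

modelGenerating? : ∀ p q a b → Dec (ModelGenerating p q a b)
modelGenerating? p q a b = modelN? p q a ×-dec modelN? p q b ×-dec modelFar? a b

Pair : Fin 6 → Fin 6 → Fin 6 → Fin 6 → Set
Pair i j a b = (a ≡ i × b ≡ j) ⊎ (a ≡ j × b ≡ i)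

pair? : ∀ i j a b → Dec (Pair i j a b)
pair? i j a b = ((a ≟ᶠ i) ×-dec (b ≟ᶠ j)) ⊎-dec ((a ≟ᶠ j) ×-dec (b ≟ᶠ i))

generating-pair-diagonal : ∀ p q → ModelFar p q → ∃ (λ r → ModelEdge p r × ModelEdge r q) →
  ∃₂ (λ a b → ModelGenerating p q a b × ModelN a b 4F) →
  ∃₂ (λ a b → ModelGenerating p q a b × ModelN a b 5F) →
  Pair 0F 2F p q ⊎ Pair 1F 3F p q
generating-pair-diagonal = from-yes (all? λ p → all? λ q → modelFar? p q →-dec
  (any? (λ r → modelEdge? p r ×-dec modelEdge? r q) →-dec
  (any? (λ a → any? λ b → modelGenerating? p q a b ×-dec modelN? a b 4F) →-dec
  (any? (λ a → any? λ b → modelGenerating? p q a b ×-dec modelN? a b 5F) →-dec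
  (pair? 0F 2F p q ⊎-dec pair? 1F 3F p q)))))

diagonal₀₂⇒diagonal₁₃ : ∀ p q → Pair 0F 2F p q →
  ∀ a b → ModelGenerating p q a b → ModelN a b 5F → Pair 1F 3F a b
diagonal₀₂⇒diagonal₁₃ = from-yes (all? λ p → all? λ q → pair? 0F 2F p q →-dec
  (all? λ a → all? λ b → modelGenerating? p q a b →-dec (modelN? a b 5F →-dec pair? 1F 3F a b)))

diagonal₁₃⇒diagonal₀₂ : ∀ p q → Pair 1F 3F p q →
  ∀ a b → ModelGenerating p q a b → ModelN a b 4F → Pair 0F 2F a b
diagonal₁₃⇒diagonal₀₂ = from-yes (all? λ p → all? λ q → pair? 1F 3F p q →-dec
  (all? λ a → all? λ b → modelGenerating? p q a b →-dec (modelN? a b 4F →-dec pair? 0F 2F a b)))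

common-neighbour₀₂ : ∀ r → ModelEdge 0F r → ModelEdge r 2F → r ≢ 4F → r ≡ 1F ⊎ r ≡ 3F
common-neighbour₀₂ = from-yes (all? λ r → modelEdge? 0F r →-dec (modelEdge? r 2F →-dec
  (¬? (r ≟ᶠ 4F) →-dec ((r ≟ᶠ 1F) ⊎-dec (r ≟ᶠ 3F)))))

common-neighbour₁₃ : ∀ t → ModelEdge 1F t → ModelEdge t 3F → t ≢ 0F → t ≢ 2F → t ≡ 5F
common-neighbour₁₃ = from-yes (all? λ t → modelEdge? 1F t →-dec (modelEdge? t 3F →-dec
  (¬? (t ≟ᶠ 0F) →-dec (¬? (t ≟ᶠ 2F) →-dec (t ≟ᶠ 5F)))))

record ModelSymmetry : Set where
  field
    perm      : Permutation′ 6
    preserves : ∀ i j → crystalMult (perm ⟨$⟩ʳ i) (perm ⟨$⟩ʳ j) ≡ crystalMult i j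

  act : Fin 6 → Fin 6
  act i = perm ⟨$⟩ʳ i

  act-injective : ∀ {i j} → act i ≡ act j → i ≡ j
  act-injective {i} {j} eq = trans (sym (inverseˡ perm)) (trans (cong (perm ⟨$⟩ˡ_) eq) (inverseˡ perm))

  act-edge : ∀ {i j} → ModelEdge i j → ModelEdge (act i) (act j)
  act-edge {i} {j} ij = ij ∘ trans (sym (preserves i j))

open ModelSymmetry

inverse : ModelSymmetry → ModelSymmetry
inverse σ = record
  { perm      = flip (perm σ)
  ; preserves = λ i j →
      trans (sym (preserves σ _ _)) (cong₂ crystalMult (inverseʳ (perm σ)) (inverseʳ (perm σ)))
  }

identity : ModelSymmetry
identity = record { perm = idₚ ; preserves = λ _ _ → refl }

_∘ₛ_ : ModelSymmetry → ModelSymmetry → ModelSymmetry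
σ ∘ₛ τ = record
  { perm      = perm τ ∘ₚ perm σ
  ; preserves = λ i j → trans (preserves σ _ _) (preserves τ i j)
  }

quarterTurn : Fin 6 → Fin 6
quarterTurn 0F = 1F
quarterTurn 1F = 2F
quarterTurn 2F = 3F
quarterTurn 3F = 0F
quarterTurn 4F = 5F
quarterTurn 5F = 4F

quarterTurn³ : Fin 6 → Fin 6
quarterTurn³ = quarterTurn ∘ quarterTurn ∘ quarterTurn

quarterTurn-inverseˡ : ∀ i → quarterTurn (quarterTurn³ i) ≡ i
quarterTurn-inverseˡ = from-yes (all? λ i → quarterTurn (quarterTurn³ i) ≟ᶠ i)

quarterTurn-inverseʳ : ∀ i → quarterTurn³ (quarterTurn i) ≡ i
quarterTurn-inverseʳ = from-yes (all? λ i → quarterTurn³ (quarterTurn i) ≟ᶠ i)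

quarterTurn-preserves : ∀ i j → crystalMult (quarterTurn i) (quarterTurn j) ≡ crystalMult i j
quarterTurn-preserves = from-yes (all? λ i → all? λ j →
  crystalMult (quarterTurn i) (quarterTurn j) ≟ crystalMult i j)

transpose₁₃-preserves : ∀ i j →
  crystalMult (transpose 1F 3F ⟨$⟩ʳ i) (transpose 1F 3F ⟨$⟩ʳ j) ≡ crystalMult i j
transpose₁₃-preserves = from-yes (all? λ i → all? λ j →
  crystalMult (transpose 1F 3F ⟨$⟩ʳ i) (transpose 1F 3F ⟨$⟩ʳ j) ≟ crystalMult i j)

rotation : ModelSymmetry
rotation = record
  { perm      = permutation quarterTurn quarterTurn³ quarterTurn-inverseˡ quarterTurn-inverseʳ
  ; preserves = quarterTurn-preserves
  }

rotation^ : ℕ → ModelSymmetry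
rotation^ zero    = identity
rotation^ (suc k) = rotation ∘ₛ rotation^ k

reflection : ModelSymmetry
reflection = record { perm = transpose 1F 3F ; preserves = transpose₁₃-preserves }

double-edge-orbit : ∀ p q → crystalMult p q ≡ 2 →
  ∃ λ (k : Fin 4) → Pair (act (rotation^ (toℕ k)) 4F) (act (rotation^ (toℕ k)) 0F) p q
double-edge-orbit = from-yes (all? λ p → all? λ q → (crystalMult p q ≟ 2) →-dec
  (any? {n = 4} λ k → pair? (act (rotation^ (toℕ k)) 4F) (act (rotation^ (toℕ k)) 0F) p q))

module Interchange {n : ℕ} (s : Fin n → ℤ) where
  open IntGr s

  open Setoid (Game n →-setoid Bool) using ()
    renaming (refl to ≈T-refl; sym to ≈T-sym; trans to ≈T-trans)

  summand : Tournament n → (Game n → Bool) → Fin n → Game n → ℤ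
  summand T G k g = if G g then sgn (T g) *ℤ coord g k else 0ℤ

  neutral-resp : ∀ {T T' G} → T ≈T T' → Neutral T G → Neutral T' G
  neutral-resp {T} {T'} {G} T≈T' neutral k =
    trans (cong sumℤ (map-cong same-summand (allGames n))) (neutral k)
    where
    same-summand : ∀ g → summand T' G k g ≡ summand T G k g
    same-summand g = cong (λ b → if G g then sgn b *ℤ coord g k else 0ℤ) (sym (T≈T' g))

  neutral-flip : ∀ T {G} → Neutral T G → Neutral (flipT T G) G
  neutral-flip T {G} neutral k = begin
    sumℤ (map (summand (flipT T G) G k) (allGames n)) ≡⟨ cong sumℤ (map-cong flipped-summand (allGames n)) ⟩
    sumℤ (map (λ g → - summand T G k g) (allGames n)) ≡⟨ sumℤ-map-neg (summand T G k) (allGames n) ⟩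
    - sumℤ (map (summand T G k) (allGames n))         ≡⟨ cong -_ (neutral k) ⟩
    0ℤ                                               ∎
    where
    open ≡-Reasoning
    flipped-summand : ∀ g → summand (flipT T G) G k g ≡ - summand T G k g
    flipped-summand g with G g
    ... | false = refl
    ... | true  =
      trans (cong (_*ℤ coord g k) (sgn-xor-true (T g))) (sym (neg-distribˡ-* (sgn (T g)) (coord g k)))

  -- Vertices occur in the relations of IntGr only under `tour`, and the source tournament of a move
  -- only under `Neutral` and `flipT`, so Agda cannot infer either: such arguments are explicit below.
  Move : ((Game n → Bool) → Set) → Tournament n → Tournament n → Set
  Move Shape T T' = Σ (Game n → Bool) λ G → Shape G × Neutral T G × (T' ≈T flipT T G)

  Adjacent : Tournament n → Tournament n → Set
  Adjacent T T' = Move IsTriangleShape T T' ⊎ Move IsCloverShape T T'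

  move-resp : ∀ {Shape T₁ T₁' T₂ T₂'} → T₁ ≈T T₁' → T₂ ≈T T₂' →
              Move Shape T₁ T₂ → Move Shape T₁' T₂'
  move-resp T₁≈ T₂≈ (G , shape , neutral , T₂≈flip) =
    G , shape , neutral-resp T₁≈ neutral ,
    λ g → trans (sym (T₂≈ g)) (trans (T₂≈flip g) (cong (_xor G g) (T₁≈ g)))

  move-respʳ : ∀ {Shape} T₁ {T₂ T₂'} → T₂ ≈T T₂' → Move Shape T₁ T₂ → Move Shape T₁ T₂'
  move-respʳ T₁ = move-resp (≈T-refl {T₁})

  move-sym : ∀ {Shape} T₁ {T₂} → Move Shape T₁ T₂ → Move Shape T₂ T₁
  move-sym T₁ (G , shape , neutral , T₂≈flip) =
    G , shape , neutral-resp (≈T-sym T₂≈flip) (neutral-flip T₁ neutral) ,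
    λ g → trans (sym (xor-involutive (G g) (T₁ g))) (cong (_xor G g) (sym (T₂≈flip g)))

  adj-resp : ∀ {T₁ T₁' T₂ T₂'} → T₁ ≈T T₁' → T₂ ≈T T₂' → Adjacent T₁ T₂ → Adjacent T₁' T₂'
  adj-resp T₁≈ T₂≈ = Sum.map (move-resp T₁≈ T₂≈) (move-resp T₁≈ T₂≈)

  adj-respˡ : ∀ {T₁ T₁' T₂} → T₁ ≈T T₁' → Adjacent T₁ T₂ → Adjacent T₁' T₂
  adj-respˡ T₁≈ = adj-resp T₁≈ ≈T-refl

  adj-respʳ : ∀ T₁ {T₂ T₂'} → T₂ ≈T T₂' → Adjacent T₁ T₂ → Adjacent T₁ T₂'
  adj-respʳ T₁ = adj-resp (≈T-refl {T₁})

  adj-sym : ∀ T₁ {T₂} → Adjacent T₁ T₂ → Adjacent T₂ T₁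
  adj-sym T₁ = Sum.map (move-sym T₁) (move-sym T₁)

  clover : Fin n → Fin n → Game n → Bool
  clover i j g = negE i j g ∨ posE i j g ∨ loopE i g

  centre partner : ∀ {X : (Game n → Bool) → Set} →
                   Σ (Game n → Bool) (λ G → IsCloverShape G × X G) → Fin n
  centre  (_ , (i , _) , _)     = i
  partner (_ , (_ , j , _) , _) = j

  clover-target : ∀ T {T'} (D : Move IsCloverShape T T') → T' ≈T flipT T (clover (centre D) (partner D))
  clover-target T (G , (_ , _ , _ , G≗) , _ , T'≈flip) g = trans (T'≈flip g) (cong (T g xor_) (G≗ g))

  clover-loop : ∀ T {T'} (D : Move IsCloverShape T T') m → T' (loop m) ≡ T (loop m) xor ⌊ m ≟ᶠ centre D ⌋
  clover-loop T D m = clover-target T D (loop m)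

  triangle-loop : ∀ T {T'} → Move IsTriangleShape T T' → ∀ m → T' (loop m) ≡ T (loop m)
  triangle-loop T (G , (_ , _ , _ , _ , G≗) , _ , T'≈flip) m =
    trans (T'≈flip (loop m)) (trans (cong (T (loop m) xor_) G-loop) (xor-identityʳ _))
    where
    G-loop : G (loop m) ≡ false
    G-loop = Sum.[ (λ G≗ → G≗ (loop m)) , (λ G≗ → G≗ (loop m)) ]′ G≗

  ⌊≟⌋-refl : ∀ (i : Fin n) → ⌊ i ≟ᶠ i ⌋ ≡ true
  ⌊≟⌋-refl i = trans (isYes≗does (i ≟ᶠ i)) (dec-true (i ≟ᶠ i) refl)

  clover-flips-centre : ∀ T {T'} (D : Move IsCloverShape T T') →
                        T' (loop (centre D)) ≡ not (T (loop (centre D)))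
  clover-flips-centre T D =
    trans (clover-loop T D _) (trans (cong (T (loop (centre D)) xor_) (⌊≟⌋-refl _)) (xor-comm _ true))

  triangle⇒¬clover : ∀ T {T'} → Move IsTriangleShape T T' → ¬ Move IsCloverShape T T'
  triangle⇒¬clover T S D = not-¬ (triangle-loop T S (centre D)) (clover-flips-centre T D)

  centre-unique : ∀ T {T₁ T₂} (D₁ : Move IsCloverShape T T₁) (D₂ : Move IsCloverShape T T₂) →
    (∀ m → T₁ (loop m) ≡ T₂ (loop m)) → centre D₁ ≡ centre D₂
  centre-unique T D₁ D₂ same-loops =
    toWitness (Equivalence.from T-≡ (trans (sym flips-agree) (⌊≟⌋-refl i)))
    where
    i : Fin n
    i = centre D₁

    flips-agree : ⌊ i ≟ᶠ i ⌋ ≡ ⌊ i ≟ᶠ centre D₂ ⌋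
    flips-agree = xor-cancelˡ (T (loop i))
      (trans (sym (clover-loop T D₁ i)) (trans (same-loops i) (clover-loop T D₂ i)))

  dist2-sym : ∀ u v → Dist2 u v → Dist2 v u
  dist2-sym u v (u≉v , ¬adj , x , ux , xv) =
    u≉v ∘ ≈T-sym , ¬adj ∘ adj-sym (tour v) , x , adj-sym (tour x) xv , adj-sym (tour u) ux

  edgeÑ-resp : ∀ u v a a' b b' → a ≈ a' → b ≈ b' → EdgeÑ u v a b → EdgeÑ u v a' b'
  edgeÑ-resp _ _ a a' b b' a≈a' b≈b' (u' , v' , u'∈ , v'∈ , far , x , cn , ends) =
    u' , v' , u'∈ , v'∈ , far , x , cn , Sum.map move (Sum.map move (Sum.map move move)) ends
    where
    move : ∀ {A B : Tournament n} → tour a ≈T A × tour b ≈T B → tour a' ≈T A × tour b' ≈T B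
    move = Product.map (≈T-trans (≈T-sym a≈a')) (≈T-trans (≈T-sym b≈b'))

  edgeÑ-ends : ∀ u v a b → EdgeÑ u v a b → VertÑ u v a × VertÑ u v b
  edgeÑ-ends u v a b (u' , v' , u'∈ , v'∈ , far , x , cn , ends) =
    Product.map (in-Ñ a) (in-Ñ b) (in-N ends)
    where
    in-Ñ : ∀ w → VertN u' v' w → VertÑ u v w
    in-Ñ w w∈ = u' , v' , u'∈ , v'∈ , far , w∈

    via-x : ∀ w → w ≈ x → VertN u' v' w
    via-x w w≈x = inj₂ (inj₂ (x , cn , w≈x))

    in-N : (a ≈ u' × b ≈ x) ⊎ (a ≈ x × b ≈ u') ⊎ (a ≈ x × b ≈ v') ⊎ (a ≈ v' × b ≈ x) →
           VertN u' v' a × VertN u' v' b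
    in-N (inj₁ (a≈u' , b≈x))               = inj₁ a≈u' , via-x b b≈x
    in-N (inj₂ (inj₁ (a≈x , b≈u')))        = via-x a a≈x , inj₁ b≈u'
    in-N (inj₂ (inj₂ (inj₁ (a≈x , b≈v')))) = via-x a a≈x , inj₂ (inj₁ b≈v')
    in-N (inj₂ (inj₂ (inj₂ (a≈v' , b≈x)))) = inj₂ (inj₁ a≈v') , via-x b b≈x

  record CrystalMap (u v : Vertex) (f : Fin 6 → Vertex) : Set where
    field
      injective    : ∀ i j → f i ≈ f j → i ≡ j
      vertex       : ∀ i → VertÑ u v (f i)
      surjective   : ∀ w → VertÑ u v w → Σ (Fin 6) λ i → w ≈ f i
      multiplicity : ∀ i j → MultÑ u v (f i) (f j) (crystalMult i j)

  crystalMap-∘ : ∀ {u v f} → CrystalMap u v f → (σ : ModelSymmetry) → CrystalMap u v (f ∘ act σ)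
  crystalMap-∘ {u} {v} {f} F σ = record
    { injective    = λ i j fσi≈fσj → act-injective σ (injective (act σ i) (act σ j) fσi≈fσj)
    ; vertex       = vertex ∘ act σ
    ; surjective   = λ w → Product.map (act (inverse σ)) (subst (λ k → w ≈ f k) (sym (inverseʳ (perm σ))))
                         ∘ surjective w
    ; multiplicity = λ i j →
        subst (MultÑ u v (f (act σ i)) (f (act σ j))) (preserves σ i j) (multiplicity (act σ i) (act σ j))
    }
    where open CrystalMap F

  module CrystalMapProperties {u v f} (F : CrystalMap u v f) where
    open CrystalMap F

    edge⇒modelEdge : ∀ p q → EdgeÑ u v (f p) (f q) → ModelEdge p q
    edge⇒modelEdge p q E m≡0 = subst (MultÑ u v (f p) (f q)) m≡0 (multiplicity p q) E

    modelEdge⇒edge : ∀ p q → ModelEdge p q → EdgeÑ u v (f p) (f q) × Adj (f p) (f q)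
    modelEdge⇒edge p q pq = from-multiplicity (crystalMult p q) pq (multiplicity p q)
      where
      from-multiplicity : ∀ m → m ≢ 0 → MultÑ u v (f p) (f q) m →
                          EdgeÑ u v (f p) (f q) × Adj (f p) (f q)
      from-multiplicity 0                   m≢0 _       = contradiction refl m≢0
      from-multiplicity 1                   _   (E , S) = E , inj₁ S
      from-multiplicity 2                   _   (E , D) = E , inj₂ D
      from-multiplicity (suc (suc (suc _))) _   ()

    adj-at : ∀ p q → ModelEdge p q → Adj (f p) (f q)
    adj-at p q = proj₂ ∘ modelEdge⇒edge p q

    single-at : ∀ p q → crystalMult p q ≡ 1 → Single (f p) (f q)
    single-at p q eq = proj₂ (subst (MultÑ u v (f p) (f q)) eq (multiplicity p q))

    double-at : ∀ p q → crystalMult p q ≡ 2 → Double (f p) (f q)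
    double-at p q eq = proj₂ (subst (MultÑ u v (f p) (f q)) eq (multiplicity p q))

    edge-positions : ∀ x y → EdgeÑ u v x y →
                     Σ (Fin 6) λ p → Σ (Fin 6) λ q → x ≈ f p × y ≈ f q × EdgeÑ u v (f p) (f q)
    edge-positions x y E with edgeÑ-ends u v x y E
    ... | x∈ , y∈ with surjective x x∈ | surjective y y∈
    ... | p , x≈fp | q , y≈fq = p , q , x≈fp , y≈fq , edgeÑ-resp u v x (f p) y (f q) x≈fp y≈fq E

    edge-at : ∀ x y p q → x ≈ f p → y ≈ f q → ModelEdge p q → EdgeÑ u v x y
    edge-at x y p q x≈fp y≈fq pq =
      edgeÑ-resp u v (f p) x (f q) y (≈T-sym x≈fp) (≈T-sym y≈fq) (proj₁ (modelEdge⇒edge p q pq))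

    double-edge⇒double-model-edge : ∀ p q → EdgeÑ u v (f p) (f q) → Double (f p) (f q) →
                                    crystalMult p q ≡ 2
    double-edge⇒double-model-edge p q E D = from-multiplicity (crystalMult p q) (multiplicity p q)
      where
      from-multiplicity : ∀ m → MultÑ u v (f p) (f q) m → m ≡ 2
      from-multiplicity 0                   ¬E      = contradiction E ¬E
      from-multiplicity 1                   (_ , S) = contradiction D (triangle⇒¬clover (tour (f p)) S)
      from-multiplicity 2                   _       = refl
      from-multiplicity (suc (suc (suc _))) ()

    -- A pair at distance two inside N(u, v), i.e. one of the pairs whose networks make up Ñ(u, v),
    -- sitting at the model positions i and j.
    record GeneratingAt (i j : Fin 6) : Set where
      constructor generating
      field
        first second : Vertex
        first∈N      : VertN u v first
        second∈N     : VertN u v second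
        far          : Dist2 first second
        first≈       : first ≈ f i
        second≈      : second ≈ f j

    module _ {i j} (P : GeneratingAt i j) where
      open GeneratingAt P

      generatingAt-swap : GeneratingAt j i
      generatingAt-swap = record
        { first = second ; second = first ; first∈N = second∈N ; second∈N = first∈N
        ; far = dist2-sym first second far ; first≈ = second≈ ; second≈ = first≈ }

      generatingAt⇒modelFar : ModelFar i j
      generatingAt⇒modelFar =
          (λ { refl → proj₁ far (≈T-trans first≈ (≈T-sym second≈)) })
        , (λ ij → proj₁ (proj₂ far) (adj-resp (≈T-sym first≈) (≈T-sym second≈) (adj-at i j ij)))

      common-neighbour-position : ∀ w → Adj (f i) w → Adj w (f j) →
        Σ (Fin 6) λ r → w ≈ f r × ModelEdge i r × ModelEdge r j
      common-neighbour-position w iw wj =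
        located (surjective w (first , second , first∈N , second∈N , far , inj₂ (inj₂ (w , cn , ≈T-refl))))
        where
        cn : CommonNb first second w
        cn = adj-respˡ (≈T-sym first≈) iw , adj-respʳ (tour w) (≈T-sym second≈) wj

        via : ∀ x y → EdgeN first second x y → EdgeÑ u v x y
        via x y E = first , second , first∈N , second∈N , far , E

        located : Σ (Fin 6) (λ r → w ≈ f r) → Σ (Fin 6) λ r → w ≈ f r × ModelEdge i r × ModelEdge r j
        located (r , w≈fr) = r , w≈fr
          , edge⇒modelEdge i r (via (f i) (f r) (w , cn , inj₁ (≈T-sym first≈ , ≈T-sym w≈fr)))
          , edge⇒modelEdge r j (via (f r) (f j) (w , cn , inj₂ (inj₂ (inj₁ (≈T-sym w≈fr , ≈T-sym second≈)))))

      N-position : ∀ w → VertN first second w → Σ (Fin 6) λ r → w ≈ f r × ModelN i j r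
      N-position w (inj₁ w≈first)                   = i , ≈T-trans w≈first first≈ , inj₁ refl
      N-position w (inj₂ (inj₁ w≈second))           = j , ≈T-trans w≈second second≈ , inj₂ (inj₁ refl)
      N-position w (inj₂ (inj₂ (x , (fx , xs) , w≈x))) =
        Product.map id (Product.map (≈T-trans w≈x) (inj₂ ∘ inj₂))
          (common-neighbour-position x (adj-respˡ first≈ fx) (adj-respʳ (tour x) second≈ xs))

      corner-in-N : ∀ t → VertN first second (f t) → ModelN i j t
      corner-in-N t t∈ with N-position (f t) t∈
      ... | r , ft≈fr , Nr = subst (ModelN i j) (sym (injective t r ft≈fr)) Nr

    orient : ∀ {i j a b} → Pair i j a b → GeneratingAt a b → GeneratingAt i j
    orient (inj₁ (refl , refl)) P = P
    orient (inj₂ (refl , refl)) P = generatingAt-swap P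

    Reaching : Fin 6 → Fin 6 → Fin 6 → Set
    Reaching p q t = Σ (Fin 6) λ a → Σ (Fin 6) λ b → GeneratingAt a b × ModelGenerating p q a b × ModelN a b t

    module _ {p q} (u≈fp : u ≈ f p) (v≈fq : v ≈ f q) (D : Dist2 u v) where

      spanning : GeneratingAt p q
      spanning = generating u v (inj₁ ≈T-refl) (inj₂ (inj₁ ≈T-refl)) D u≈fp v≈fq

      reaching : ∀ t → Reaching p q t
      reaching t with vertex t
      ... | u' , v' , u'∈ , v'∈ , far , t∈
          with N-position spanning u' u'∈ | N-position spanning v' v'∈
      ... | a , u'≈fa , Na | b , v'≈fb , Nb =
        a , b , P , (Na , Nb , generatingAt⇒modelFar P) , corner-in-N P t t∈
        where
        P : GeneratingAt a b
        P = generating u' v' u'∈ v'∈ far u'≈fa v'≈fb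

      common-model-neighbour : ∃ λ r → ModelEdge p r × ModelEdge r q
      common-model-neighbour = located (proj₂ (proj₂ D))
        where
        located : Σ Vertex (λ x → Adj u x × Adj x v) → ∃ λ r → ModelEdge p r × ModelEdge r q
        located (x , ux , xv) =
          Product.map id proj₂
            (common-neighbour-position spanning x (adj-respˡ u≈fp ux) (adj-respʳ (tour x) v≈fq xv))

      other-diagonal : ∀ {t k l} → (∀ a b → ModelGenerating p q a b → ModelN a b t → Pair k l a b) →
        Reaching p q t → GeneratingAt k l
      other-diagonal pair (a , b , P , g , t∈) = orient (pair a b g t∈) P

      diagonals-from : Pair 0F 2F p q ⊎ Pair 1F 3F p q → GeneratingAt 0F 2F × GeneratingAt 1F 3F
      diagonals-from (inj₁ pq₀₂) =
        orient pq₀₂ spanning , other-diagonal (diagonal₀₂⇒diagonal₁₃ p q pq₀₂) (reaching 5F)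
      diagonals-from (inj₂ pq₁₃) =
        other-diagonal (diagonal₁₃⇒diagonal₀₂ p q pq₁₃) (reaching 4F) , orient pq₁₃ spanning

    -- (u, v) lies on one diagonal of the square, since both hubs must be reached; the generating pair
    -- through which the opposite hub enters Ñ(u, v) lies on the other diagonal.
    diagonals : Dist2 u v → GeneratingAt 0F 2F × GeneratingAt 1F 3F
    diagonals D with surjective u (u , v , inj₁ ≈T-refl , inj₂ (inj₁ ≈T-refl) , D , inj₁ ≈T-refl)
                   | surjective v (u , v , inj₁ ≈T-refl , inj₂ (inj₁ ≈T-refl) , D , inj₂ (inj₁ ≈T-refl))
    ... | p , u≈fp | q , v≈fq = diagonals-from u≈fp v≈fq D
      (generating-pair-diagonal p q (generatingAt⇒modelFar (spanning u≈fp v≈fq D))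
        (common-model-neighbour u≈fp v≈fq D) (forget (reaching u≈fp v≈fq D 4F)) (forget (reaching u≈fp v≈fq D 5F)))
      where
      forget : ∀ {t} → Reaching p q t → ∃₂ λ a b → ModelGenerating p q a b × ModelN a b t
      forget (a , b , _ , g , t∈) = a , b , g , t∈

  UpToSymmetry : (Fin 6 → Vertex) → (Fin 6 → Vertex) → Set
  UpToSymmetry f g = Σ ModelSymmetry λ σ → ∀ i → f i ≈ g (act σ i)

  module _ {u v f u' v' g} (F : CrystalMap u v f) (G : CrystalMap u' v' g) where
    private
      module F = CrystalMapProperties F
      module G = CrystalMapProperties G

    edges-along : (σ : ModelSymmetry) → (∀ i → f i ≈ g (act σ i)) → ∀ x y → EdgeÑ u v x y → EdgeÑ u' v' x y
    edges-along σ f≈gσ x y E with F.edge-positions x y E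
    ... | p , q , x≈fp , y≈fq , E' = G.edge-at x y (act σ p) (act σ q)
      (≈T-trans x≈fp (f≈gσ p)) (≈T-trans y≈fq (f≈gσ q)) (act-edge σ (F.edge⇒modelEdge p q E'))

    crystal-rigidity : Dist2 u' v' → f 0F ≈ g 0F → f 2F ≈ g 2F → f 4F ≈ g 4F → UpToSymmetry f g
    crystal-rigidity D' f0≈g0 f2≈g2 f4≈g4 =
      match (corner-image 1F (λ ()) (λ ()) (λ ())) (corner-image 3F (λ ()) (λ ()) (λ ()))
      where
      P₀₂ : G.GeneratingAt 0F 2F
      P₀₂ = proj₁ (G.diagonals D')

      P₁₃ : G.GeneratingAt 1F 3F
      P₁₃ = proj₂ (G.diagonals D')

      f-injective : ∀ {i j r} → f i ≈ g r → f j ≈ g r → i ≡ j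
      f-injective {i} {j} fi≈gr fj≈gr = CrystalMap.injective F i j (≈T-trans fi≈gr (≈T-sym fj≈gr))

      ImageOn₁₃ : Fin 6 → Set
      ImageOn₁₃ k = Σ (Fin 6) λ r → f k ≈ g r × (r ≡ 1F ⊎ r ≡ 3F)

      corner-image : ∀ k → ModelEdge 0F k → ModelEdge k 2F → k ≢ 4F → ImageOn₁₃ k
      corner-image k 0k k2 k≢4 = located (G.common-neighbour-position P₀₂ (f k)
        (adj-respˡ f0≈g0 (F.adj-at 0F k 0k)) (adj-respʳ (tour (f k)) f2≈g2 (F.adj-at k 2F k2)))
        where
        located : Σ (Fin 6) (λ r → f k ≈ g r × ModelEdge 0F r × ModelEdge r 2F) → ImageOn₁₃ k
        located (r , fk≈gr , 0r , r2) =
          r , fk≈gr , common-neighbour₀₂ r 0r r2 λ { refl → k≢4 (f-injective fk≈gr f4≈g4) }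

      fifth-corner : Adj (g 1F) (f 5F) → Adj (f 5F) (g 3F) → f 5F ≈ g 5F
      fifth-corner 1-5 5-3 = located (G.common-neighbour-position P₁₃ (f 5F) 1-5 5-3)
        where
        located : Σ (Fin 6) (λ t → f 5F ≈ g t × ModelEdge 1F t × ModelEdge t 3F) → f 5F ≈ g 5F
        located (t , f5≈gt , 1t , t3) = subst (λ k → f 5F ≈ g k) (common-neighbour₁₃ t 1t t3
          (λ { refl → contradiction (f-injective f5≈gt f0≈g0) λ () })
          (λ { refl → contradiction (f-injective f5≈gt f2≈g2) λ () })) f5≈gt

      match : ImageOn₁₃ 1F → ImageOn₁₃ 3F → UpToSymmetry f g
      match (_ , f1≈g1 , inj₁ refl) (_ , f3≈g3 , inj₂ refl) = identity , λ
        { 0F → f0≈g0 ; 1F → f1≈g1 ; 2F → f2≈g2 ; 3F → f3≈g3 ; 4F → f4≈g4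
        ; 5F → fifth-corner (adj-respˡ f1≈g1 (F.adj-at 1F 5F (λ ())))
                            (adj-respʳ (tour (f 5F)) f3≈g3 (F.adj-at 5F 3F (λ ()))) }
      match (_ , f1≈g3 , inj₂ refl) (_ , f3≈g1 , inj₁ refl) = reflection , λ
        { 0F → f0≈g0 ; 1F → f1≈g3 ; 2F → f2≈g2 ; 3F → f3≈g1 ; 4F → f4≈g4
        ; 5F → fifth-corner (adj-respˡ f3≈g1 (F.adj-at 3F 5F (λ ())))
                            (adj-respʳ (tour (f 5F)) f1≈g3 (F.adj-at 5F 1F (λ ()))) }
      match (_ , f1≈g1 , inj₁ refl) (_ , f3≈g1 , inj₁ refl) =
        contradiction (f-injective f1≈g1 f3≈g1) λ ()
      match (_ , f1≈g3 , inj₂ refl) (_ , f3≈g3 , inj₂ refl) =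
        contradiction (f-injective f1≈g3 f3≈g3) λ ()

  sameNet-by-symmetry : ∀ {u v f u' v' g} → CrystalMap u v f → CrystalMap u' v' g →
                        UpToSymmetry f g → SameNet (u , v) (u' , v')
  sameNet-by-symmetry {f = f} {g = g} F G (σ , f≈gσ) x y =
    edges-along F G σ f≈gσ x y , edges-along G F (inverse σ) g≈fσ⁻¹ x y
    where
    g≈fσ⁻¹ : ∀ i → g i ≈ f (act (inverse σ) i)
    g≈fσ⁻¹ i = subst (λ k → g k ≈ f (act (inverse σ) i)) (inverseʳ (perm σ)) (≈T-sym (f≈gσ (act (inverse σ) i)))

  record Anchored (a b u v : Vertex) : Set where
    field
      corner     : Fin 6 → Vertex
      crystalMap : CrystalMap u v corner
      far        : Dist2 u v
      hub≈       : a ≈ corner 4F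
      base≈      : b ≈ corner 0F

    spoke : Vertex
    spoke = corner 2F

  open Anchored

  Anchored± : Vertex → Vertex → Vertex → Vertex → Set
  Anchored± a b u v = Anchored a b u v ⊎ Anchored b a u v

  module _ {a b u v} (A : Anchored a b u v) where
    private
      module C = CrystalMapProperties (crystalMap A)

    hub-spoke : Double a (spoke A)
    hub-spoke = move-resp (≈T-sym (hub≈ A)) ≈T-refl (C.double-at 4F 2F refl)

    spoke-loops : ∀ m → tour (spoke A) (loop m) ≡ tour b (loop m)
    spoke-loops m = begin
      tour (corner A 2F) (loop m) ≡⟨ triangle-loop (tour (corner A 1F)) (C.single-at 1F 2F refl) m ⟩
      tour (corner A 1F) (loop m) ≡⟨ triangle-loop (tour (corner A 0F)) (C.single-at 0F 1F refl) m ⟩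
      tour (corner A 0F) (loop m) ≡⟨ sym (base≈ A (loop m)) ⟩
      tour b (loop m)             ∎
      where open ≡-Reasoning

    spoke-partner : Fin n
    spoke-partner = partner hub-spoke

    spoke-as-clover : (ab : Double a b) → tour (spoke A) ≈T flipT (tour a) (clover (centre ab) spoke-partner)
    spoke-as-clover ab = subst (λ i → tour (spoke A) ≈T flipT (tour a) (clover i spoke-partner))
      (centre-unique (tour a) hub-spoke ab spoke-loops) (clover-target (tour a) hub-spoke)

  anchored-sameNet : ∀ {a b u v u' v'} (A : Anchored a b u v) (A' : Anchored a b u' v') →
    spoke A ≈ spoke A' → SameNet (u , v) (u' , v')
  anchored-sameNet A A' spoke≈ = sameNet-by-symmetry (crystalMap A) (crystalMap A')
    (crystal-rigidity (crystalMap A) (crystalMap A') (far A')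
      (≈T-trans (≈T-sym (base≈ A)) (base≈ A')) spoke≈ (≈T-trans (≈T-sym (hub≈ A)) (hub≈ A')))

  anchoring : ∀ a b u v → Double a b → IsCrystal u v → EdgeÑ u v a b → Anchored± a b u v
  anchoring a b u v ab (D , f , injective , vertex , surjective , multiplicity) E =
    positioned (C.edge-positions a b E)
    where
    F : CrystalMap u v f
    F = record { injective = injective ; vertex = vertex ; surjective = surjective ; multiplicity = multiplicity }

    module C = CrystalMapProperties F

    ρ : Fin 4 → ModelSymmetry
    ρ k = rotation^ (toℕ k)

    anchored : ∀ {x y} k → x ≈ f (act (ρ k) 4F) → y ≈ f (act (ρ k) 0F) → Anchored x y u v
    anchored k x≈ y≈ = record { corner = f ∘ act (ρ k) ; crystalMap = crystalMap-∘ F (ρ k) ; far = D ; hub≈ = x≈ ; base≈ = y≈ }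

    oriented : ∀ {p q} → a ≈ f p → b ≈ f q → (∃ λ k → Pair (act (ρ k) 4F) (act (ρ k) 0F) p q) → Anchored± a b u v
    oriented a≈fp b≈fq (k , inj₁ (refl , refl)) = inj₁ (anchored k a≈fp b≈fq)
    oriented a≈fp b≈fq (k , inj₂ (refl , refl)) = inj₂ (anchored k b≈fq a≈fp)

    positioned : (Σ (Fin 6) λ p → Σ (Fin 6) λ q → a ≈ f p × b ≈ f q × EdgeÑ u v (f p) (f q)) → Anchored± a b u v
    positioned (p , q , a≈fp , b≈fq , E') =
      oriented a≈fp b≈fq (double-edge-orbit p q (C.double-edge⇒double-model-edge p q E' (move-resp a≈fp b≈fq ab)))

  record SpokeCode (a b : Vertex) (m : ℕ) : Set where
    field
      code           : ∀ {u v} → Anchored a b u v → Fin m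
      code-injective : ∀ {u v u' v'} (A : Anchored a b u v) (A' : Anchored a b u' v') →
                       code A ≡ code A' → spoke A ≈ spoke A'

  open SpokeCode

  partner-code : ∀ a b → Double a b → SpokeCode a b n
  partner-code a b ab = record
    { code           = spoke-partner
    ; code-injective = λ A A' same-partner g → begin
        tour (spoke A) g                                         ≡⟨ spoke-as-clover A ab g ⟩
        flipT (tour a) (clover (centre ab) (spoke-partner A)) g  ≡⟨ cong (clover-flip g) same-partner ⟩
        flipT (tour a) (clover (centre ab) (spoke-partner A')) g ≡⟨ spoke-as-clover A' ab g ⟨
        tour (spoke A') g                                        ∎
    }
    where
    open ≡-Reasoning

    clover-flip : Game n → Fin n → Bool
    clover-flip g k = flipT (tour a) (clover (centre ab) k) g

  double-neighbour∈doubles : ∀ u w {L} → All (λ p → Adj u (proj₁ p) × Mult u (proj₁ p) (proj₂ p)) L →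
                             Double u w → Any (λ p → w ≈ proj₁ p) L → Any (w ≈_) (doubles L)
  double-neighbour∈doubles u w {(y , m) ∷ L} ((uy , uy-mult) ∷ _) uw (here w≈y) = found m uy-mult
    where
    found : ∀ m → Mult u y m → Any (w ≈_) (doubles ((y , m) ∷ L))
    found 0                   ¬uy = contradiction uy ¬uy
    found 1                   S   = contradiction (move-respʳ (tour u) w≈y uw) (triangle⇒¬clover (tour u) S)
    found 2                   _   = here w≈y
    found (suc (suc (suc _))) ()
  double-neighbour∈doubles u w {(y , m) ∷ L} (_ ∷ neighbours) uw (there w∈L) =
    skip m (double-neighbour∈doubles u w neighbours uw w∈L)
    where
    skip : ∀ m → Any (w ≈_) (doubles L) → Any (w ≈_) (doubles ((y , m) ∷ L))
    skip 0                   = id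
    skip 1                   = id
    skip 2                   = there
    skip (suc (suc (suc _))) = id

  neighbour-code : ∀ a b {d} (deg : HasDegree a d) → SpokeCode a b (length (doubles (proj₁ deg)))
  neighbour-code a b (L , neighbours , _ , exhaustive , _) = record
    { code           = index ∘ spoke∈doubles
    ; code-injective = λ A A' same-index → ≈T-trans (lookup-index (spoke∈doubles A))
        (subst (λ i → lookup (doubles L) i ≈ spoke A') (sym same-index) (≈T-sym (lookup-index (spoke∈doubles A'))))
    }
    where
    spoke∈doubles : ∀ {u v} (A : Anchored a b u v) → Any (spoke A ≈_) (doubles L)
    spoke∈doubles A =
      double-neighbour∈doubles a (spoke A) neighbours (hub-spoke A) (exhaustive (spoke A) (inj₂ (hub-spoke A)))

  doubles≤degree : ∀ u {d} (deg : HasDegree u d) →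
                   length (doubles (proj₁ deg)) + length (doubles (proj₁ deg)) ≤ d
  doubles≤degree u (L , _ , _ , _ , sum≡d) = ≤-trans (length-doubles L) (≤-reflexive sum≡d)

  crystals-through≤ : ∀ a b {m m'} → Double a b → SpokeCode a b m → SpokeCode b a m' → ∀ {L} →
    All (λ p → IsCrystal (proj₁ p) (proj₂ p) × EdgeÑ (proj₁ p) (proj₂ p) a b) L →
    AllPairs (λ p q → ¬ SameNet p q) L → length L ≤ m + m'
  crystals-through≤ a b {m} {m'} ab codeᵃ codeᵇ = separating-key⇒length≤ key separated
    where
    Through : Vertex × Vertex → Set
    Through (u , v) = IsCrystal u v × EdgeÑ u v a b

    anchor : ∀ {p} → Through p → Anchored± a b (proj₁ p) (proj₂ p)
    anchor {u , v} (crystal , E) = anchoring a b u v ab crystal E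

    code± : ∀ {u v} → Anchored± a b u v → Fin m ⊎ Fin m'
    code± = Sum.map (code codeᵃ) (code codeᵇ)

    key : ∀ {p} → Through p → Fin (m + m')
    key = join m m' ∘ code± ∘ anchor

    same-code⇒sameNet : ∀ {u v u' v'} (X : Anchored± a b u v) (Y : Anchored± a b u' v') →
                        code± X ≡ code± Y → SameNet (u , v) (u' , v')
    same-code⇒sameNet (inj₁ A) (inj₁ A') eq = anchored-sameNet A A' (code-injective codeᵃ A A' (inj₁-injective eq))
    same-code⇒sameNet (inj₂ B) (inj₂ B') eq = anchored-sameNet B B' (code-injective codeᵇ B B' (inj₂-injective eq))
    same-code⇒sameNet (inj₁ _) (inj₂ _) ()
    same-code⇒sameNet (inj₂ _) (inj₁ _) ()

    separated : ∀ {p q} (P : Through p) (Q : Through q) → ¬ SameNet p q → key P ≢ key Q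
    separated P Q ¬same eq = ¬same (same-code⇒sameNet (anchor P) (anchor Q) (join-injective m m' eq))

lemma23 : {n : ℕ} (s : Fin n → ℤ) → InScore s →
    (d : ℕ) → IntGr.IsDegree s d →
    (a b : IntGr.Vertex s) → IntGr.Double s a b →
    (L : List (IntGr.Vertex s × IntGr.Vertex s)) →
    All (λ p → IntGr.IsCrystal s (proj₁ p) (proj₂ p) × IntGr.EdgeÑ s (proj₁ p) (proj₂ p) a b) L →
    AllPairs (λ p q → ¬ IntGr.SameNet s p q) L →
    length L ≤ d ⊓ (2 * n)
-- s ∈ Score(C_n) only makes IntGr(C_n, s) non-empty; the bound holds without it.
lemma23 {n} s _ d degree a b ab L through distinct = ⊓-glb by-degree by-size
  where
  open IntGr s using (tour)
  open Interchange s

  by-degree : length L ≤ d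
  by-degree = ≤-trans
    (crystals-through≤ a b ab (neighbour-code a b (degree a)) (neighbour-code b a (degree b)) through distinct)
    (m+m≤o⇒n+n≤o⇒m+n≤o {m = length (doubles (proj₁ (degree a)))}
      (doubles≤degree a (degree a)) (doubles≤degree b (degree b)))

  by-size : length L ≤ 2 * n
  by-size = ≤-trans
    (crystals-through≤ a b ab (partner-code a b ab) (partner-code b a (move-sym (tour a) ab)) through distinct)
    (≤-reflexive (cong (n +_) (sym (+-identityʳ n))))
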